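{- Let $n\geqslant 4$. Every vertex of the Bubble-sort graph $BS_n$ belongs to exactly $(n-2)(n-3)/2$ distinct $4$-cycles, and every $4$-cycle of $BS_n$ has the canonical form $$C_4=(b_j\,b_i)^2=b_j\,b_i\,b_j\,b_i,\qquad 1\leqslant i<j-1\leqslant n-2.$$ In total, $BS_n$ contains $\frac{(n-2)(n-3)\,n!}{8}$ distinct $4$-cycles.
   Context: For $n\geqslant 2$, $Sym_n$ is the symmetric group of permutations $\pi=[\pi_1\pi_2\ldots\pi_n]$ of $\{1,\dots,n\}$. For $1\leqslant i\leqslant n-1$ let $b_i=(i\ i+1)$; multiplying $\pi$ on the right by $b_i$ swaps the entries in positions $i$ and $i+1$. The Bubble-sort graph $BS_n$ is the Cayley graph $Cay(Sym_n,\{b_1,\dots,b_{n-1}\})$: vertices are the permutations, and $\pi$ is adjacent to $\pi b_i$ for each $i$. A form of an $\ell$-cycle is a sequence $b_{i_0}b_{i_1}\cdots b_{i_{\ell-1}}$ with $i_j\neq i_{j+1}$ (indices cyclic) such that starting at a vertex $\pi$ and successively multiplying on the right by $b_{i_0},b_{i_1},\dots$ traces the cycle and returns to $\pi$, i.e. $\pi b_{i_0}\cdots b_{i_{\ell-1}}=\pi$. Each $\ell$-cycle has $2\ell$ forms (choice of starting vertex and direction); its canonical form is the one whose index sequence $i_0\ldots i_{\ell-1}$ is lexicographically maximal. $(b_ab_b)^k$ denotes the word $b_ab_b$ repeated $k$ times. -}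

module Defs where

open import Data.Nat using (ℕ; zero; suc; _∸_; _<_; _<?_)
open import Data.Fin using (Fin)
import Data.Fin as Fin
open import Data.Vec using (Vec; []; _∷_; toList)
import Data.Vec.Properties as VecP
open import Data.List using (List; []; _∷_; map; filter; upTo; allFin; cartesianProductWith; deduplicate)
open import Data.List.Relation.Unary.Any using (Any; any?)
open import Data.List.Relation.Unary.All using (All; all?)
open import Data.List.Relation.Unary.Unique.Propositional using (Unique)
import Data.List.Relation.Unary.Unique.DecPropositional as UDec
open import Data.List.Membership.Propositional using (_∈_)
import Data.List.Membership.DecPropositional as MemDec
open import Data.Product using (_×_; _,_)
open import Relation.Nullary using (Dec; ¬_; ¬?)
open import Relation.Nullary.Decidable using (_×-dec_)
open import Relation.Binary.PropositionalEquality using (_≡_)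
open import Relation.Binary.Definitions using (DecidableEquality)

-- Permutations of {1,…,n}, written in one-line notation [π₁ … πₙ]
-- as a vector of length n over Fin n (entry value k : Fin n stands
-- for k+1).

Word : ℕ → Set
Word n = Vec (Fin n) n

IsPerm : ∀ {n} → Word n → Set
IsPerm v = Unique (toList v)

_≟W_ : ∀ {n} → DecidableEquality (Word n)
_≟W_ = VecP.≡-dec Fin._≟_

isPerm? : ∀ {n} (v : Word n) → Dec (IsPerm v)
isPerm? v = UDec.unique? Fin._≟_ (toList v)

allVecs : ∀ {A : Set} → List A → (k : ℕ) → List (Vec A k)
allVecs xs zero    = [] ∷ []
allVecs xs (suc k) = cartesianProductWith _∷_ xs (allVecs xs k)

perms : (n : ℕ) → List (Word n)
perms n = filter isPerm? (allVecs (allFin n) n)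

-- Right multiplication by b_i = (i i+1): swaps the entries in the
-- positions i and i+1 (1-based).  'swap0 k' swaps the 0-based
-- positions k and k+1.

swap0 : ∀ {A : Set} {m} → ℕ → Vec A m → Vec A m
swap0 zero    (x ∷ y ∷ xs) = y ∷ x ∷ xs
swap0 (suc k) (x ∷ xs)     = x ∷ swap0 k xs
swap0 _       xs           = xs

_·b_ : ∀ {n} → Word n → ℕ → Word n
π ·b i = swap0 (i ∸ 1) π

gens : ℕ → List ℕ
gens n = map suc (upTo (n ∸ 1))

Adj : ∀ {n} → Word n → Word n → Set
Adj {n} u v = Any (λ i → v ≡ u ·b i) (gens n)

adj? : ∀ {n} (u v : Word n) → Dec (Adj u v)
adj? {n} u v = any? (λ i → v ≟W (u ·b i)) (gens n)

Quad : Set → Set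
Quad A = Vec A 4

IsCycle4 : ∀ {n} → Quad (Word n) → Set
IsCycle4 (a ∷ b ∷ c ∷ d ∷ []) =
  All IsPerm (a ∷ b ∷ c ∷ d ∷ []) × Unique (a ∷ b ∷ c ∷ d ∷ []) ×
  Adj a b × Adj b c × Adj c d × Adj d a

isCycle4? : ∀ {n} (C : Quad (Word n)) → Dec (IsCycle4 C)
isCycle4? (a ∷ b ∷ c ∷ d ∷ []) =
  all? isPerm? (a ∷ b ∷ c ∷ d ∷ []) ×-dec UDec.unique? _≟W_ (a ∷ b ∷ c ∷ d ∷ []) ×-dec
  adj? a b ×-dec adj? b c ×-dec adj? c d ×-dec adj? d a

-- the 8 traversals of the same cycle (choice of start vertex and direction)
traversals : ∀ {A : Set} → Quad A → List (Quad A)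
traversals (a ∷ b ∷ c ∷ d ∷ []) =
  (a ∷ b ∷ c ∷ d ∷ []) ∷ (b ∷ c ∷ d ∷ a ∷ []) ∷ (c ∷ d ∷ a ∷ b ∷ []) ∷ (d ∷ a ∷ b ∷ c ∷ []) ∷
  (a ∷ d ∷ c ∷ b ∷ []) ∷ (d ∷ c ∷ b ∷ a ∷ []) ∷ (c ∷ b ∷ a ∷ d ∷ []) ∷ (b ∷ a ∷ d ∷ c ∷ []) ∷ []

SameCycle : ∀ {n} → Quad (Word n) → Quad (Word n) → Set
SameCycle C D = D ∈ traversals C

sameCycle? : ∀ {n} (C D : Quad (Word n)) → Dec (SameCycle C D)
sameCycle? C D = MemDec._∈?_ (VecP.≡-dec _≟W_) D (traversals C)

cycleSeqs : (n : ℕ) → List (Quad (Word n))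
cycleSeqs n = filter isCycle4? (allVecs (perms n) 4)

cycles4 : (n : ℕ) → List (Quad (Word n))
cycles4 n = deduplicate sameCycle? (cycleSeqs n)

cycles4At : ∀ {n} → Word n → List (Quad (Word n))
cycles4At {n} π = deduplicate sameCycle? (filter (λ C → MemDec._∈?_ _≟W_ π (toList C)) (cycleSeqs n))

FormOfSeq : ∀ {n} → Quad (Word n) → Quad ℕ → Set
FormOfSeq {n} (w₀ ∷ w₁ ∷ w₂ ∷ w₃ ∷ []) (i₀ ∷ i₁ ∷ i₂ ∷ i₃ ∷ []) =
  All (_∈ gens n) (i₀ ∷ i₁ ∷ i₂ ∷ i₃ ∷ []) ×
  (¬ i₀ ≡ i₁) × (¬ i₁ ≡ i₂) × (¬ i₂ ≡ i₃) × (¬ i₃ ≡ i₀) ×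
  w₁ ≡ w₀ ·b i₀ × w₂ ≡ w₁ ·b i₁ × w₃ ≡ w₂ ·b i₂ × w₀ ≡ w₃ ·b i₃

IsFormOf : ∀ {n} → Quad ℕ → Quad (Word n) → Set
IsFormOf s C = Any (λ D → FormOfSeq D s) (traversals C)

data _≤lex_ : ∀ {k} → Vec ℕ k → Vec ℕ k → Set where
  []≤ : [] ≤lex []
  <≤  : ∀ {k x y} {xs ys : Vec ℕ k} → x < y → (x ∷ xs) ≤lex (y ∷ ys)
  ≡≤  : ∀ {k x} {xs ys : Vec ℕ k} → xs ≤lex ys → (x ∷ xs) ≤lex (x ∷ ys)

IsCanonicalForm : ∀ {n} → Quad ℕ → Quad (Word n) → Set
IsCanonicalForm s C = IsFormOf s C × (∀ t → IsFormOf t C → t ≤lex s)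

-- A 4-cycle a ~ b ~ c ~ d ~ a of BS_n has b = a b_p, c = b b_q, d = c b_r and a = d b_t, so
-- a b_p b_q = a b_t b_r.  As a is injective, b_p b_q = b_t b_r as permutations of positions, and
-- comparing their least and greatest moved positions gives {p, q} = {t, r}; b ≠ d excludes p = t,
-- so b_p and b_q commute, i.e. |p − q| ≥ 2.  Hence every 4-cycle is a square (b_i b_j)^2 of two
-- commuting generators, determined by its start vertex and the ordered pair (i, j), and every
-- such square is a 4-cycle: (n−2)(n−3) cycle sequences start at each vertex.  A 4-cycle has
-- 8 traversals, exactly two of which start at a given vertex of it, which yields both counts.
-- Along any traversal every step is b_i or b_j, so the forms alternate between i and j and the
-- largest is (b_j b_i)^2 with i < j.

module Submission where

open import Defs
open import Data.Nat
  using (ℕ; zero; suc; pred; _+_; _*_; _∸_; _/_; _!; _≤_; _<_; _⊓_; _⊔_; z≤n; s≤s; s≤s⁻¹; s<s⁻¹; NonZero)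
import Data.Nat.Properties as ℕ
open import Data.Nat.Properties
  using (≤-antisym; ≤-total; ≤-<-trans; <-trans; <-cmp; <-irrefl; <⇒≤; <⇒≢; ≮⇒≥; n<1+n; m<n⇒m<1+n;
         m≤n⇒m<n∨m≡n; suc-injective; 1+n≢n; 1+n≰n; m≤n⇒m⊓n≡m; m≥n⇒m⊓n≡n; m≤n⇒m⊔n≡n; m≥n⇒m⊔n≡m;
         m⊓n≤m; ⊔-lub; *-comm)
open import Data.Nat.DivMod using (m*n/n≡m)
open import Data.Nat.Tactic.RingSolver using (solve-∀)
open import Data.Fin using (Fin; zero; suc; #_)
import Data.Fin as Fin
open import Data.Maybe using (Maybe; just; nothing)
open import Data.Vec using (Vec; []; _∷_; toList; lookup; head)
import Data.Vec as Vec
import Data.Vec.Properties as VecP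
open import Data.Vec.Membership.Propositional.Properties using (∈-lookup; ∈-toList⁺)
open import Data.List using (List; []; _∷_; _++_; map; filter; concat; length; upTo; allFin; deduplicate; cartesianProductWith)
open import Data.List.Properties using (length-++; length-map; length-upTo; length-tabulate; filter-++; filter-all)
open import Data.List.Relation.Unary.Any using (here; there)
import Data.List.Relation.Unary.Any as Any
open import Data.List.Relation.Unary.All using (All; []; _∷_; all?)
import Data.List.Relation.Unary.All as All
import Data.List.Relation.Unary.All.Properties as AllP
open import Data.List.Relation.Unary.AllPairs using (AllPairs; []; _∷_)
import Data.List.Relation.Unary.AllPairs as AllPairs
import Data.List.Relation.Unary.AllPairs.Properties as AllPairsP
open import Data.List.Relation.Unary.Unique.Propositional using (Unique)
import Data.List.Relation.Unary.Unique.Propositional.Properties as UniqueP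
import Data.List.Relation.Unary.Unique.DecPropositional as UniqueDec
open import Data.List.Membership.Propositional using (_∈_; _∉_; find)
open import Data.List.Membership.Propositional.Properties
  using (∈-filter⁺; ∈-filter⁻; ∈-map⁺; ∈-map⁻; ∈-concat⁺′; ∈-concat⁻′; ∈-deduplicate⁻; ∈-cartesianProductWith⁺;
         ∈-cartesianProductWith⁻; ∈-allFin; ∈-upTo⁺; ∈-upTo⁻; ∈-++⁺ˡ; ∈-++⁺ʳ; ∈-++⁻)
open import Data.List.Membership.Propositional.Properties.WithK using (unique∧set⇒bag)
import Data.List.Membership.DecPropositional as MembershipDec
open import Data.List.Relation.Binary.BagAndSetEquality using (∼bag⇒↭)
open import Data.List.Relation.Binary.Permutation.Propositional using (prep; ↭-sym)
open import Data.List.Relation.Binary.Permutation.Propositional.Properties using (↭-length; ∈-resp-↭; shift; ↭-reverse)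
open import Data.Product using (∃; ∃₂; _×_; _,_; proj₁; proj₂)
open import Data.Sum using (_⊎_; inj₁; inj₂)
import Data.Sum as Sum
open import Data.Empty using (⊥)
open import Data.Unit using (⊤; tt)
open import Function using (_∘_)
open import Function.Bundles using (mk⇔)
open import Relation.Binary using (tri<; tri≈; tri>)
open import Relation.Binary.Definitions using (DecidableEquality)
open import Relation.Binary.PropositionalEquality
  using (_≡_; _≢_; refl; sym; trans; cong; cong₂; subst; subst₂; ≢-sym; module ≡-Reasoning)
open import Relation.Nullary using (Dec; yes; no; ¬?; contradiction)
open import Relation.Nullary.Decidable using (toWitness)
open import Relation.Unary using (Pred; Decidable)

module _ {a} {A : Set a} where

  unique∧set⇒length≡ : ∀ {xs ys : List A} → Unique xs → Unique ys →
    (∀ {x} → x ∈ xs → x ∈ ys) → (∀ {x} → x ∈ ys → x ∈ xs) → length xs ≡ length ys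
  unique∧set⇒length≡ uxs uys to from = ↭-length (∼bag⇒↭ (unique∧set⇒bag uxs uys (mk⇔ to from)))

  length-concat-const : ∀ (xss : List (List A)) k → All (λ xs → length xs ≡ k) xss →
    length (concat xss) ≡ length xss * k
  length-concat-const []         k []       = refl
  length-concat-const (xs ∷ xss) k (p ∷ ps) =
    trans (length-++ xs) (cong₂ _+_ p (length-concat-const xss k ps))

module _ {a b} {A : Set a} {B : Set b} where

  Unique-map⁺-injectiveOn : ∀ (f : A → B) {xs} → (∀ {x y} → x ∈ xs → y ∈ xs → f x ≡ f y → x ≡ y) →
    Unique xs → Unique (map f xs)
  Unique-map⁺-injectiveOn f {[]}     inj []         = []
  Unique-map⁺-injectiveOn f {x ∷ xs} inj (x∉ ∷ uxs) =
    AllP.map⁺ (All.tabulate (λ y∈ fx≡fy → All.lookup x∉ y∈ (inj (here refl) (there y∈) fx≡fy)))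
    ∷ Unique-map⁺-injectiveOn f (λ x∈ y∈ → inj (there x∈) (there y∈)) uxs

module _ {a b p q} {A : Set a} {B : Set b} {P : Pred B p} {Q : Pred A q} (P? : Decidable P) (Q? : Decidable Q) where

  length-filter-map : ∀ (g : A → B) → (∀ {x} → P (g x) → Q x) → (∀ {x} → Q x → P (g x)) →
    ∀ xs → length (filter P? (map g xs)) ≡ length (filter Q? xs)
  length-filter-map g to from []       = refl
  length-filter-map g to from (x ∷ xs) with P? (g x) | Q? x
  ... | yes _   | yes _   = cong suc (length-filter-map g to from xs)
  ... | yes Pgx | no ¬Qx  = contradiction (to Pgx) ¬Qx
  ... | no ¬Pgx | yes Qx  = contradiction (from Qx) ¬Pgx
  ... | no _    | no _    = length-filter-map g to from xs

module _ {a b c p} {A : Set a} {B : Set b} {C : Set c} {P : Pred C p} (P? : Decidable P) where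

  length-filter-cartesianProductWith : ∀ (f : A → B → C) xs ys k →
    (∀ {x} → x ∈ xs → length (filter P? (map (f x) ys)) ≡ k) →
    length (filter P? (cartesianProductWith f xs ys)) ≡ length xs * k
  length-filter-cartesianProductWith f []       ys k row = refl
  length-filter-cartesianProductWith f (x ∷ xs) ys k row = begin
    length (filter P? (map (f x) ys ++ cartesianProductWith f xs ys))
      ≡⟨ cong length (filter-++ P? (map (f x) ys) _) ⟩
    length (filter P? (map (f x) ys) ++ filter P? (cartesianProductWith f xs ys))
      ≡⟨ length-++ (filter P? (map (f x) ys)) ⟩
    length (filter P? (map (f x) ys)) + length (filter P? (cartesianProductWith f xs ys))
      ≡⟨ cong₂ _+_ (row (here refl)) (length-filter-cartesianProductWith f xs ys k (row ∘ there)) ⟩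
    k + length xs * k ∎
    where open ≡-Reasoning

module Orbits {a} {A : Set a} (orbit : A → List A) (R? : ∀ x y → Dec (y ∈ orbit x))
  (orbit-refl : ∀ x → x ∈ orbit x)
  (orbit-sym : ∀ {x y} → y ∈ orbit x → x ∈ orbit y)
  (orbit-trans : ∀ {x y z} → y ∈ orbit x → z ∈ orbit y → z ∈ orbit x) where

  private
    reps : List A → List A
    reps = deduplicate R?

    reps-apart : ∀ L → AllPairs (λ x y → y ∉ orbit x) (reps L)
    reps-apart []      = []
    reps-apart (x ∷ L) = AllP.all-filter (¬? ∘ R? x) (reps L) ∷ AllPairsP.filter⁺ (¬? ∘ R? x) (reps-apart L)

    reps-cover : ∀ L {y} → y ∈ L → ∃ λ x → x ∈ reps L × y ∈ orbit x
    reps-cover (x ∷ L) (here refl) = x , here refl , orbit-refl x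
    reps-cover (x ∷ L) (there y∈) with reps-cover L y∈
    ... | z , z∈ , y∈z with R? x z
    ...   | yes z∈x = x , here refl , orbit-trans z∈x y∈z
    ...   | no  z∉x = z , there (∈-filter⁺ (¬? ∘ R? x) z∈ z∉x) , y∈z

  length-filter≡dedup*k : ∀ {p} {P : Pred A p} (P? : Decidable P) (L : List A) k → Unique L →
    (∀ {x y} → x ∈ L → y ∈ orbit x → y ∈ L) →
    (∀ {x} → x ∈ L → Unique (orbit x)) →
    (∀ {x} → x ∈ L → length (filter P? (orbit x)) ≡ k) →
    length (filter P? L) ≡ length (deduplicate R? L) * k
  length-filter≡dedup*k P? L k uL closed uorbit size = begin
    length (filter P? L)  ≡⟨ unique∧set⇒length≡ (UniqueP.filter⁺ P? uL) uM to from ⟩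
    length (concat rows)  ≡⟨ length-concat-const rows k (AllP.map⁺ (All.tabulate (size ∘ ∈-reps⁻))) ⟩
    length rows * k       ≡⟨ cong (_* k) (length-map row (reps L)) ⟩
    length (reps L) * k   ∎
    where
      open ≡-Reasoning
      row : A → List A
      row = filter P? ∘ orbit
      rows = map row (reps L)
      ∈-reps⁻ = ∈-deduplicate⁻ R? L
      uM : Unique (concat rows)
      uM = UniqueP.concat⁺
        (AllP.map⁺ (All.tabulate (UniqueP.filter⁺ P? ∘ uorbit ∘ ∈-reps⁻)))
        (AllPairsP.map⁺ (AllPairs.map disjoint (reps-apart L)))
        where
          disjoint : ∀ {x y} → y ∉ orbit x → ∀ {z} → z ∈ row x × z ∈ row y → ⊥
          disjoint y∉x (z∈x , z∈y) =
            y∉x (orbit-trans (proj₁ (∈-filter⁻ P? z∈x)) (orbit-sym (proj₁ (∈-filter⁻ P? z∈y))))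
      to : ∀ {y} → y ∈ filter P? L → y ∈ concat rows
      to y∈ with ∈-filter⁻ P? y∈
      ... | y∈L , Py with reps-cover L y∈L
      ...   | x , x∈ , y∈x = ∈-concat⁺′ (∈-filter⁺ P? y∈x Py) (∈-map⁺ row x∈)
      from : ∀ {y} → y ∈ concat rows → y ∈ filter P? L
      from y∈ with ∈-concat⁻′ rows y∈
      ... | ys , y∈ys , ys∈ with ∈-map⁻ row ys∈
      ...   | x , x∈ , refl with ∈-filter⁻ P? y∈ys
      ...     | y∈x , Py = ∈-filter⁺ P? (closed (∈-reps⁻ x∈) y∈x) Py

  length≡dedup*k : ∀ (L : List A) k → Unique L →
    (∀ {x y} → x ∈ L → y ∈ orbit x → y ∈ L) →
    (∀ {x} → x ∈ L → Unique (orbit x)) →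
    (∀ {x} → x ∈ L → length (orbit x) ≡ k) →
    length L ≡ length (deduplicate R? L) * k
  length≡dedup*k L k uL closed uorbit size =
    trans (sym (length-filter-all L))
          (length-filter≡dedup*k always? L k uL closed uorbit (λ {x} x∈ → trans (length-filter-all (orbit x)) (size x∈)))
    where
      always? : Decidable {A = A} (λ _ → ⊤)
      always? _ = yes tt
      length-filter-all : ∀ xs → length (filter always? xs) ≡ length xs
      length-filter-all xs = cong length (filter-all always? {xs = xs} (All.tabulate (λ _ → tt)))

module _ {A : Set} {xs : List A} where

  ∈-allVecs⁺ : ∀ {k} (v : Vec A k) → All (_∈ xs) (toList v) → v ∈ allVecs xs k
  ∈-allVecs⁺ []      []          = here refl
  ∈-allVecs⁺ (x ∷ v) (x∈ ∷ v⊆) = ∈-cartesianProductWith⁺ _∷_ x∈ (∈-allVecs⁺ v v⊆)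

  ∈-allVecs⁻ : ∀ {k} {v : Vec A k} → v ∈ allVecs xs k → All (_∈ xs) (toList v)
  ∈-allVecs⁻ {zero}  {[]}    _  = []
  ∈-allVecs⁻ {suc k} {x ∷ v} v∈ with ∈-cartesianProductWith⁻ _∷_ xs (allVecs xs k) v∈
  ... | _ , _ , x∈ , v∈′ , refl = x∈ ∷ ∈-allVecs⁻ v∈′

  allVecs-unique : ∀ k → Unique xs → Unique (allVecs xs k)
  allVecs-unique zero    _   = [] ∷ []
  allVecs-unique (suc k) uxs = UniqueP.cartesianProductWith⁺ _∷_ VecP.∷-injective uxs (allVecs-unique k uxs)

fallingFactorial : ℕ → ℕ → ℕ
fallingFactorial m zero    = 1
fallingFactorial m (suc k) = m * fallingFactorial (pred m) k

fallingFactorial-! : ∀ n → fallingFactorial n n ≡ n !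
fallingFactorial-! zero    = refl
fallingFactorial-! (suc n) = cong (suc n *_) (fallingFactorial-! n)

module InjectiveWords {A : Set} (_≟_ : DecidableEquality A) where

  injective? : ∀ {k} (v : Vec A k) → Dec (Unique (toList v))
  injective? v = UniqueDec.unique? _≟_ (toList v)

  remove : A → List A → List A
  remove x = filter (λ y → ¬? (y ≟ x))

  suc-length-remove : ∀ {x xs} → Unique xs → x ∈ xs → suc (length (remove x xs)) ≡ length xs
  suc-length-remove {x} {xs} uxs x∈ = unique∧set⇒length≡
      (All.tabulate (λ y∈ x≡y → proj₂ (∈-filter⁻ _ {xs = xs} y∈) (sym x≡y)) ∷ UniqueP.filter⁺ _ uxs) uxs
      (λ { (here refl) → x∈ ; (there y∈) → proj₁ (∈-filter⁻ _ {xs = xs} y∈) })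
      (λ {y} y∈ → restore y∈ (y ≟ x))
    where
      restore : ∀ {y} → y ∈ xs → Dec (y ≡ x) → y ∈ x ∷ remove x xs
      restore _  (yes refl) = here refl
      restore y∈ (no  y≢x)  = there (∈-filter⁺ _ y∈ y≢x)

  length-injectiveWords : ∀ k xs → Unique xs →
    length (filter injective? (allVecs xs k)) ≡ fallingFactorial (length xs) k
  length-injectiveWords zero    xs uxs = refl
  length-injectiveWords (suc k) xs uxs =
    length-filter-cartesianProductWith injective? _∷_ xs (allVecs xs k) _ startingWith
    where
      startingWith : ∀ {x} → x ∈ xs →
        length (filter injective? (map (x ∷_) (allVecs xs k))) ≡ fallingFactorial (pred (length xs)) k
      startingWith {x} x∈ = begin
        length (filter injective? (map (x ∷_) (allVecs xs k)))
          ≡⟨ unique∧set⇒length≡ u₁ u₂ to from ⟩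
        length (map (x ∷_) (filter injective? (allVecs (remove x xs) k)))
          ≡⟨ length-map (λ (v : Vec A k) → x ∷ v) (filter injective? (allVecs (remove x xs) k)) ⟩
        length (filter injective? (allVecs (remove x xs) k))
          ≡⟨ length-injectiveWords k (remove x xs) (UniqueP.filter⁺ _ uxs) ⟩
        fallingFactorial (length (remove x xs)) k
          ≡⟨ cong (λ m → fallingFactorial (pred m) k) (suc-length-remove uxs x∈) ⟩
        fallingFactorial (pred (length xs)) k ∎
        where
          open ≡-Reasoning
          u₁ = UniqueP.filter⁺ injective? (UniqueP.map⁺ VecP.∷-injectiveʳ (allVecs-unique k uxs))
          u₂ = UniqueP.map⁺ VecP.∷-injectiveʳ (UniqueP.filter⁺ injective? (allVecs-unique k (UniqueP.filter⁺ _ uxs)))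
          to : ∀ {w} → w ∈ filter injective? (map (x ∷_) (allVecs xs k)) →
               w ∈ map (x ∷_) (filter injective? (allVecs (remove x xs) k))
          to w∈ with ∈-filter⁻ injective? {xs = map (x ∷_) (allVecs xs k)} w∈
          ... | w∈′ , uw with ∈-map⁻ (x ∷_) w∈′
          ...   | v , v∈ , refl with uw
          ...     | x∉v ∷ uv = ∈-map⁺ (x ∷_) (∈-filter⁺ injective? (∈-allVecs⁺ v
                    (All.zipWith (λ (y∈ , x≢y) → ∈-filter⁺ _ y∈ (x≢y ∘ sym)) (∈-allVecs⁻ v∈ , x∉v))) uv)
          from : ∀ {w} → w ∈ map (x ∷_) (filter injective? (allVecs (remove x xs) k)) →
                 w ∈ filter injective? (map (x ∷_) (allVecs xs k))
          from w∈ with ∈-map⁻ (x ∷_) w∈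
          ... | v , v∈ , refl with ∈-filter⁻ injective? v∈
          ...   | v∈′ , uv =
            ∈-filter⁺ injective? (∈-map⁺ (x ∷_) (∈-allVecs⁺ v (All.map (proj₁ ∘ ∈-filter⁻ _ {xs = xs}) v⊆)))
                  (All.map (λ y∈ x≡y → proj₂ (∈-filter⁻ _ {xs = xs} y∈) (sym x≡y)) v⊆ ∷ uv)
            where v⊆ = ∈-allVecs⁻ v∈′

length-perms : ∀ n → length (perms n) ≡ n !
length-perms n = begin
  length (filter isPerm? (allVecs (allFin n) n))  ≡⟨ length-injectiveWords n (allFin n) (UniqueP.allFin⁺ n) ⟩
  fallingFactorial (length (allFin n)) n          ≡⟨ cong (λ m → fallingFactorial m n) (length-tabulate (λ i → i)) ⟩
  fallingFactorial n n                            ≡⟨ fallingFactorial-! n ⟩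
  n !                                             ∎
  where open ≡-Reasoning
        open InjectiveWords (Fin._≟_ {n})

∈-perms⁺ : ∀ {n} {π : Word n} → IsPerm π → π ∈ perms n
∈-perms⁺ {n} {π} uπ = ∈-filter⁺ isPerm? (∈-allVecs⁺ π (All.tabulate (λ {i} _ → ∈-allFin i))) uπ

∈-perms⁻ : ∀ {n} {π : Word n} → π ∈ perms n → IsPerm π
∈-perms⁻ {n} π∈ = proj₂ (∈-filter⁻ isPerm? {xs = allVecs (allFin n) n} π∈)

perms-unique : ∀ n → Unique (perms n)
perms-unique n = UniqueP.filter⁺ isPerm? (allVecs-unique n (UniqueP.allFin⁺ n))

-- Products of two transpositions of ℕ

NonAdjacent : ℕ → ℕ → Set
NonAdjacent i j = suc i < j ⊎ suc j < i

nonAdjacent⇒≢ : ∀ {i j} → NonAdjacent i j → i ≢ j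
nonAdjacent⇒≢ (inj₁ si<j) refl = 1+n≰n (<⇒≤ si<j)
nonAdjacent⇒≢ (inj₂ sj<i) refl = 1+n≰n (<⇒≤ sj<i)

τ : ℕ → ℕ → ℕ
τ zero    zero          = 1
τ zero    (suc zero)    = 0
τ zero    (suc (suc x)) = suc (suc x)
τ (suc p) zero          = zero
τ (suc p) (suc x)       = suc (τ p x)

τ-involutive : ∀ p x → τ p (τ p x) ≡ x
τ-involutive zero    zero          = refl
τ-involutive zero    (suc zero)    = refl
τ-involutive zero    (suc (suc x)) = refl
τ-involutive (suc p) zero          = refl
τ-involutive (suc p) (suc x)       = cong suc (τ-involutive p x)

τ-self : ∀ p → τ p p ≡ suc p
τ-self zero    = refl
τ-self (suc p) = cong suc (τ-self p)

τ-suc-self : ∀ p → τ p (suc p) ≡ p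
τ-suc-self zero    = refl
τ-suc-self (suc p) = cong suc (τ-suc-self p)

τ-fixes-below : ∀ {p x} → x < p → τ p x ≡ x
τ-fixes-below {suc p} {zero}  _         = refl
τ-fixes-below {suc p} {suc x} (s≤s x<p) = cong suc (τ-fixes-below x<p)

τ-fixes-above : ∀ {p x} → suc p < x → τ p x ≡ x
τ-fixes-above {zero}  {suc zero}    (s≤s ())
τ-fixes-above {zero}  {suc (suc x)} _         = refl
τ-fixes-above {suc p} {suc x}       (s≤s p<x) = cong suc (τ-fixes-above p<x)

τ-≢-suc : ∀ {p q} → q ≢ p → τ p q ≢ suc q
τ-≢-suc {zero}  {zero}        q≢p = contradiction refl q≢p
τ-≢-suc {zero}  {suc zero}    _   = λ ()
τ-≢-suc {zero}  {suc (suc q)} _   = λ ()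
τ-≢-suc {suc p} {zero}        _   = λ ()
τ-≢-suc {suc p} {suc q}       q≢p = τ-≢-suc (q≢p ∘ cong suc) ∘ suc-injective

τ-< : ∀ {p x n} → suc p < n → x < n → τ p x < n
τ-< {zero}  {zero}        p<n _   = p<n
τ-< {zero}  {suc zero}    p<n _   = <-trans (s≤s z≤n) p<n
τ-< {zero}  {suc (suc x)} _   x<n = x<n
τ-< {suc p} {zero}        p<n _   = <-trans (s≤s z≤n) p<n
τ-< {suc p} {suc x} {suc n} (s≤s p<n) (s≤s x<n) = s≤s (τ-< p<n x<n)

τ-adjacent-noncommuting : ∀ p → τ p (τ (suc p) p) ≢ τ (suc p) (τ p p)
τ-adjacent-noncommuting p e = 1+n≢n (sym (trans (sym lhs) (trans e rhs)))
  where
    lhs : τ p (τ (suc p) p) ≡ suc p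
    lhs = trans (cong (τ p) (τ-fixes-below (n<1+n p))) (τ-self p)
    rhs : τ (suc p) (τ p p) ≡ suc (suc p)
    rhs = trans (cong (τ (suc p)) (τ-self p)) (τ-self (suc p))

record SupportBounds (f : ℕ → ℕ) (lo hi : ℕ) : Set where
  field
    moves-lo : f lo ≢ lo
    moves-hi : f hi ≢ hi
    between  : ∀ x → f x ≢ x → lo ≤ x × x ≤ hi

supportBounds : ∀ {f lo hi} → f lo ≢ lo → f hi ≢ hi →
  (∀ x → x < lo → f x ≡ x) → (∀ x → hi < x → f x ≡ x) → SupportBounds f lo hi
supportBounds moves-lo moves-hi below above = record
  { moves-lo = moves-lo
  ; moves-hi = moves-hi
  ; between  = λ x moved → ≮⇒≥ (moved ∘ below x) , ≮⇒≥ (moved ∘ above x)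
  }

supportBounds-inverse : ∀ {f g lo hi} → (∀ x → f (g x) ≡ x) → (∀ x → g (f x) ≡ x) →
  SupportBounds f lo hi → SupportBounds g lo hi
supportBounds-inverse {f} {g} f∘g g∘f S = record
  { moves-lo = λ e → moves-lo (trans (sym (cong f e)) (f∘g _))
  ; moves-hi = λ e → moves-hi (trans (sym (cong f e)) (f∘g _))
  ; between  = λ x moved → between x (λ e → moved (trans (sym (cong g e)) (g∘f x)))
  }
  where open SupportBounds S

supportBounds-unique : ∀ {f g lo hi lo′ hi′ n} → (∀ x → x < n → f x ≡ g x) → hi < n → hi′ < n →
  SupportBounds f lo hi → SupportBounds g lo′ hi′ → lo ≡ lo′ × hi ≡ hi′
supportBounds-unique {f} {g} {lo} {hi} {lo′} {hi′} f≗g hi<n hi′<n S T =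
  ≤-antisym (proj₁ (S.between lo′ moved-lo′)) (proj₁ (T.between lo moved-lo)) ,
  ≤-antisym (proj₂ (T.between hi moved-hi)) (proj₂ (S.between hi′ moved-hi′))
  where
    module S = SupportBounds S
    module T = SupportBounds T
    moved-lo : g lo ≢ lo
    moved-lo e = S.moves-lo (trans (f≗g lo (≤-<-trans (proj₂ (S.between lo S.moves-lo)) hi<n)) e)
    moved-hi : g hi ≢ hi
    moved-hi e = S.moves-hi (trans (f≗g hi hi<n) e)
    moved-lo′ : f lo′ ≢ lo′
    moved-lo′ e = T.moves-lo (trans (sym (f≗g lo′ (≤-<-trans (proj₂ (T.between lo′ T.moves-lo)) hi′<n))) e)
    moved-hi′ : f hi′ ≢ hi′
    moved-hi′ e = T.moves-hi (trans (sym (f≗g hi′ hi′<n)) e)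

supportBounds-τ∘τ-< : ∀ {p q} → p < q → SupportBounds (τ p ∘ τ q) p (suc q)
supportBounds-τ∘τ-< {p} {q} p<q = supportBounds
  (λ e → 1+n≢n (trans (sym (trans (cong (τ p) (τ-fixes-below p<q)) (τ-self p))) e))
  (λ e → τ-≢-suc (≢-sym (<⇒≢ p<q)) (trans (sym (cong (τ p) (τ-suc-self q))) e))
  (λ x x<p → trans (cong (τ p) (τ-fixes-below (<-trans x<p p<q))) (τ-fixes-below x<p))
  (λ x q<x → trans (cong (τ p) (τ-fixes-above q<x)) (τ-fixes-above (<-trans (s≤s p<q) q<x)))

supportBounds-τ∘τ : ∀ {p q} → p ≢ q → SupportBounds (τ p ∘ τ q) (p ⊓ q) (suc (p ⊔ q))
supportBounds-τ∘τ {p} {q} p≢q with <-cmp p q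
... | tri< p<q _ _ = subst₂ (SupportBounds (τ p ∘ τ q))
        (sym (m≤n⇒m⊓n≡m (<⇒≤ p<q))) (cong suc (sym (m≤n⇒m⊔n≡n (<⇒≤ p<q))))
        (supportBounds-τ∘τ-< p<q)
... | tri≈ _ p≡q _ = contradiction p≡q p≢q
... | tri> _ _ q<p = subst₂ (SupportBounds (τ p ∘ τ q))
        (sym (m≥n⇒m⊓n≡n (<⇒≤ q<p))) (cong suc (sym (m≥n⇒m⊔n≡m (<⇒≤ q<p))))
        (supportBounds-inverse (λ x → inverse q p x) (λ x → inverse p q x) (supportBounds-τ∘τ-< q<p))
  where
    inverse : ∀ a b x → τ a (τ b (τ b (τ a x))) ≡ x
    inverse a b x = trans (cong (τ a) (τ-involutive b (τ a x))) (τ-involutive a x)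

⊓-⊔-determine : ∀ {p q t r} → p ⊓ q ≡ t ⊓ r → p ⊔ q ≡ t ⊔ r → (p ≡ t × q ≡ r) ⊎ (p ≡ r × q ≡ t)
⊓-⊔-determine {p} {q} {t} {r} ⊓≡ ⊔≡ with ≤-total p q | ≤-total t r
... | inj₁ p≤q | inj₁ t≤r
  rewrite m≤n⇒m⊓n≡m p≤q | m≤n⇒m⊔n≡n p≤q | m≤n⇒m⊓n≡m t≤r | m≤n⇒m⊔n≡n t≤r = inj₁ (⊓≡ , ⊔≡)
... | inj₁ p≤q | inj₂ r≤t
  rewrite m≤n⇒m⊓n≡m p≤q | m≤n⇒m⊔n≡n p≤q | m≥n⇒m⊓n≡n r≤t | m≥n⇒m⊔n≡m r≤t = inj₂ (⊓≡ , ⊔≡)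
... | inj₂ q≤p | inj₁ t≤r
  rewrite m≥n⇒m⊓n≡n q≤p | m≥n⇒m⊔n≡m q≤p | m≤n⇒m⊓n≡m t≤r | m≤n⇒m⊔n≡n t≤r = inj₂ (⊔≡ , ⊓≡)
... | inj₂ q≤p | inj₂ r≤t
  rewrite m≥n⇒m⊓n≡n q≤p | m≥n⇒m⊔n≡m q≤p | m≥n⇒m⊓n≡n r≤t | m≥n⇒m⊔n≡m r≤t = inj₁ (⊔≡ , ⊓≡)

nonAdjacent-if-commuting : ∀ {p q n} → p ≢ q → p < n → q < n →
  (∀ x → x < n → τ p (τ q x) ≡ τ q (τ p x)) → NonAdjacent p q
nonAdjacent-if-commuting {p} {q} p≢q p<n q<n comm with <-cmp p q
... | tri≈ _ p≡q _ = contradiction p≡q p≢q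
... | tri< p<q _ _ with m≤n⇒m<n∨m≡n p<q
...   | inj₁ sp<q = inj₁ sp<q
...   | inj₂ refl = contradiction (comm p p<n) (τ-adjacent-noncommuting p)
nonAdjacent-if-commuting {p} {q} p≢q p<n q<n comm | tri> _ _ q<p with m≤n⇒m<n∨m≡n q<p
...   | inj₁ sq<p = inj₂ sq<p
...   | inj₂ refl = contradiction (sym (comm q q<n)) (τ-adjacent-noncommuting q)

module _ {A : Set} where

  -- Positions are indexed by ℕ (with nothing past the end) so that τ can act on them.
  entry : ∀ {m} → Vec A m → ℕ → Maybe A
  entry []      _       = nothing
  entry (x ∷ v) zero    = just x
  entry (x ∷ v) (suc k) = entry v k

  entry-swap0 : ∀ {m} p (v : Vec A m) → suc p < m → ∀ k → entry (swap0 p v) k ≡ entry v (τ p k)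
  entry-swap0 zero    (x ∷ y ∷ v) _         zero          = refl
  entry-swap0 zero    (x ∷ y ∷ v) _         (suc zero)    = refl
  entry-swap0 zero    (x ∷ y ∷ v) _         (suc (suc k)) = refl
  entry-swap0 zero    (x ∷ [])    (s≤s ())  _
  entry-swap0 (suc p) (x ∷ v)     _         zero          = refl
  entry-swap0 (suc p) (x ∷ v)     (s≤s p<m) (suc k)       = entry-swap0 p v p<m k

  entry-∈ : ∀ {m} (v : Vec A m) k {x} → entry v k ≡ just x → x ∈ toList v
  entry-∈ (y ∷ v) zero    refl = here refl
  entry-∈ (y ∷ v) (suc k) e    = there (entry-∈ v k e)

  entry-injective : ∀ {m} (v : Vec A m) → Unique (toList v) → ∀ {x y} → x < m → entry v x ≡ entry v y → x ≡ y
  entry-injective (a ∷ v) (a∉ ∷ uv) {zero}  {zero}  _         _ = refl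
  entry-injective (a ∷ v) (a∉ ∷ uv) {zero}  {suc y} _         e = contradiction refl (All.lookup a∉ (entry-∈ v y (sym e)))
  entry-injective (a ∷ v) (a∉ ∷ uv) {suc x} {zero}  _         e = contradiction refl (All.lookup a∉ (entry-∈ v x e))
  entry-injective (a ∷ v) (a∉ ∷ uv) {suc x} {suc y} (s≤s x<m) e = cong suc (entry-injective v uv x<m e)

  swap0-involutive : ∀ {m} p (v : Vec A m) → swap0 p (swap0 p v) ≡ v
  swap0-involutive zero    []          = refl
  swap0-involutive zero    (x ∷ [])    = refl
  swap0-involutive zero    (x ∷ y ∷ v) = refl
  swap0-involutive (suc p) []          = refl
  swap0-involutive (suc p) (x ∷ v)     = cong (x ∷_) (swap0-involutive p v)

  swap0-comm : ∀ {m} p q (v : Vec A m) → suc p < q → swap0 p (swap0 q v) ≡ swap0 q (swap0 p v)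
  swap0-comm zero    (suc (suc q)) []          _         = refl
  swap0-comm zero    (suc (suc q)) (x ∷ [])    _         = refl
  swap0-comm zero    (suc (suc q)) (x ∷ y ∷ v) _         = refl
  swap0-comm zero    (suc zero)    v           (s≤s ())
  swap0-comm (suc p) (suc q)       []          _         = refl
  swap0-comm (suc p) (suc q)       (x ∷ v)     (s≤s p<q) = cong (x ∷_) (swap0-comm p q v p<q)

  All-swap0 : ∀ {P : A → Set} {m} p (v : Vec A m) → All P (toList v) → All P (toList (swap0 p v))
  All-swap0 zero    (x ∷ y ∷ v) (px ∷ py ∷ pv) = py ∷ px ∷ pv
  All-swap0 zero    []          []             = []
  All-swap0 zero    (x ∷ [])    pv             = pv
  All-swap0 (suc p) []          []             = []
  All-swap0 (suc p) (x ∷ v)     (px ∷ pv)      = px ∷ All-swap0 p v pv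

  Unique-swap0 : ∀ {m} p (v : Vec A m) → Unique (toList v) → Unique (toList (swap0 p v))
  Unique-swap0 zero    (x ∷ y ∷ v) ((x≢y ∷ x∉) ∷ y∉ ∷ uv) = (≢-sym x≢y ∷ y∉) ∷ x∉ ∷ uv
  Unique-swap0 zero    []          uv                      = uv
  Unique-swap0 zero    (x ∷ [])    uv                      = uv
  Unique-swap0 (suc p) []          uv                      = uv
  Unique-swap0 (suc p) (x ∷ v)     (x∉ ∷ uv)               = All-swap0 p v x∉ ∷ Unique-swap0 p v uv

  swaps : ∀ {m} → List ℕ → Vec A m → Vec A m
  swaps []       v = v
  swaps (p ∷ ps) v = swaps ps (swap0 p v)

swap0-comm-nonAdjacent : ∀ {A : Set} {m p q} (v : Vec A m) → NonAdjacent p q →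
  swap0 p (swap0 q v) ≡ swap0 q (swap0 p v)
swap0-comm-nonAdjacent {p = p} {q} v (inj₁ sp<q) = swap0-comm p q v sp<q
swap0-comm-nonAdjacent {p = p} {q} v (inj₂ sq<p) = sym (swap0-comm q p v sq<p)

τs : List ℕ → ℕ → ℕ
τs []       x = x
τs (p ∷ ps) x = τ p (τs ps x)

InRange : ℕ → ℕ → Set
InRange m p = suc p < m

τs-< : ∀ {m x} ps → All (InRange m) ps → x < m → τs ps x < m
τs-< []       []            x<m = x<m
τs-< (p ∷ ps) (p<m ∷ ps<m) x<m = τ-< p<m (τs-< ps ps<m x<m)

module _ {A : Set} {m : ℕ} where

  entry-swaps : ∀ ps (v : Vec A m) → All (InRange m) ps → ∀ k → entry (swaps ps v) k ≡ entry v (τs ps k)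
  entry-swaps []       v []            k = refl
  entry-swaps (p ∷ ps) v (p<m ∷ ps<m) k =
    trans (entry-swaps ps (swap0 p v) ps<m k) (entry-swap0 p v p<m (τs ps k))

  swaps-positions : ∀ {ps qs} (v : Vec A m) → Unique (toList v) → All (InRange m) ps → All (InRange m) qs →
    swaps ps v ≡ swaps qs v → ∀ x → x < m → τs ps x ≡ τs qs x
  swaps-positions {ps} {qs} v uv ps<m qs<m e x x<m = entry-injective v uv (τs-< ps ps<m x<m)
    (trans (sym (entry-swaps ps v ps<m x)) (trans (cong (λ w → entry w x) e) (entry-swaps qs v qs<m x)))

module _ {A : Set} {m : ℕ} {a : Vec A m} (ua : Unique (toList a)) where

  swap0-moves : ∀ {p} → suc p < m → swap0 p a ≢ a
  swap0-moves {p} p<m e =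
    1+n≢n (trans (sym (τ-self p)) (swaps-positions a ua (p<m ∷ []) [] e p (<-trans (n<1+n p) p<m)))

  swap0-injective : ∀ {p q} → suc p < m → suc q < m → swap0 p a ≡ swap0 q a → p ≡ q
  swap0-injective {p} {q} p<m q<m e with p ℕ.≟ q
  ... | yes p≡q = p≡q
  ... | no  p≢q = contradiction (trans (sym τp≡τq) (τ-self p)) (τ-≢-suc p≢q)
    where τp≡τq = swaps-positions a ua (p<m ∷ []) (q<m ∷ []) e p (<-trans (n<1+n p) p<m)

  swap0²-moves : ∀ {p q} → suc p < m → suc q < m → p ≢ q → swap0 q (swap0 p a) ≢ a
  swap0²-moves {p} {q} p<m q<m p≢q e = SupportBounds.moves-lo (supportBounds-τ∘τ p≢q)
    (swaps-positions a ua (p<m ∷ q<m ∷ []) [] e (p ⊓ q) (≤-<-trans (m⊓n≤m p q) (<-trans (n<1+n p) p<m)))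

  swap0²-determines : ∀ {p q t r} → suc p < m → suc q < m → suc t < m → suc r < m →
    p ≢ q → t ≢ r → p ≢ t → swap0 q (swap0 p a) ≡ swap0 r (swap0 t a) →
    p ≡ r × q ≡ t × NonAdjacent p q
  swap0²-determines {p} {q} {t} {r} p<m q<m t<m r<m p≢q t≢r p≢t e
    with supportBounds-unique agree (⊔-lub p<m q<m) (⊔-lub t<m r<m) (supportBounds-τ∘τ p≢q) (supportBounds-τ∘τ t≢r)
    where agree = swaps-positions a ua (p<m ∷ q<m ∷ []) (t<m ∷ r<m ∷ []) e
  ... | lo≡ , hi≡ with ⊓-⊔-determine lo≡ (suc-injective hi≡)
  ...   | inj₁ (p≡t , _)   = contradiction p≡t p≢t
  ...   | inj₂ (refl , refl) = refl , refl ,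
          nonAdjacent-if-commuting p≢q (<-trans (n<1+n p) p<m) (<-trans (n<1+n q) q<m)
            (swaps-positions a ua (p<m ∷ q<m ∷ []) (q<m ∷ p<m ∷ []) e)

-- Generators and 4-cycles of BS_n

∈-gens⁺ : ∀ {n p} → suc p < n → suc p ∈ gens n
∈-gens⁺ {suc n} (s≤s p<n) = ∈-map⁺ suc (∈-upTo⁺ p<n)

∈-gens⁻ : ∀ {n i} → i ∈ gens n → ∃ λ p → i ≡ suc p × suc p < n
∈-gens⁻ {suc n} i∈ with ∈-map⁻ suc i∈
... | p , p∈ , refl = p , refl , s≤s (∈-upTo⁻ p∈)

gens-unique : ∀ n → Unique (gens n)
gens-unique n = UniqueP.map⁺ suc-injective (UniqueP.upTo⁺ (n ∸ 1))

length-gens : ∀ n → length (gens n) ≡ n ∸ 1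
length-gens n = trans (length-map suc (upTo (n ∸ 1))) (length-upTo (n ∸ 1))

∈-gens⇒< : ∀ {n i} → i ∈ gens n → i < n
∈-gens⇒< {n} i∈ with ∈-gens⁻ {n} i∈
... | p , refl , p<n = p<n

∈-gens-suc⁺ : ∀ {n i} → i ∈ gens n → i ∈ gens (suc n)
∈-gens-suc⁺ {n} i∈ with ∈-gens⁻ {n} i∈
... | p , refl , p<n = ∈-gens⁺ {suc n} (m<n⇒m<1+n p<n)

∈-gens-suc⁻ : ∀ {n i} → i ∈ gens (suc n) → i ∈ gens n ⊎ i ≡ n
∈-gens-suc⁻ {n} i∈ with ∈-gens⁻ {suc n} i∈
... | p , refl , p<sn with m≤n⇒m<n∨m≡n (s≤s⁻¹ p<sn)
...   | inj₁ p<n  = inj₁ (∈-gens⁺ {n} p<n)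
...   | inj₂ sp≡n = inj₂ sp≡n

module _ {n : ℕ} where

  Adj⁺ : ∀ {u v : Word n} {p} → suc p < n → v ≡ swap0 p u → Adj u v
  Adj⁺ p<n e = Any.map (λ { refl → e }) (∈-gens⁺ {n} p<n)

  Adj⁻ : ∀ {u v : Word n} → Adj u v → ∃ λ p → suc p < n × v ≡ swap0 p u
  Adj⁻ uv with find uv
  ... | i , i∈ , e with ∈-gens⁻ {n} i∈
  ...   | p , refl , p<n = p , p<n , e

  Adj-sym : ∀ {u v : Word n} → Adj u v → Adj v u
  Adj-sym uv with Adj⁻ uv
  ... | p , p<n , refl = Adj⁺ p<n (sym (swap0-involutive p _))

  square : Word n → ℕ × ℕ → Quad (Word n)
  square a (i , j) = a ∷ a ·b i ∷ (a ·b i) ·b j ∷ a ·b j ∷ []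

  IsCycle4⇒square : ∀ {a b c d : Word n} → IsCycle4 (a ∷ b ∷ c ∷ d ∷ []) →
    ∃₂ λ i j → i ∈ gens n × j ∈ gens n × NonAdjacent i j × (a ∷ b ∷ c ∷ d ∷ []) ≡ square a (i , j)
  IsCycle4⇒square {a} ((ua ∷ _) , ((a≢b ∷ a≢c ∷ _) ∷ (_ ∷ b≢d ∷ []) ∷ _) , ab , bc , cd , da)
    with Adj⁻ ab | Adj⁻ bc | Adj⁻ cd | Adj⁻ da
  ... | p , p<n , refl | q , q<n , refl | r , r<n , refl | t , t<n , a≡ = square-from d≡
    (swap0²-determines ua p<n q<n t<n r<n p≢q t≢r p≢t c≡)
    where
      d≡ : swap0 r (swap0 q (swap0 p a)) ≡ swap0 t a
      d≡ = trans (sym (swap0-involutive t _)) (cong (swap0 t) (sym a≡))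
      c≡ : swap0 q (swap0 p a) ≡ swap0 r (swap0 t a)
      c≡ = trans (sym (swap0-involutive r _)) (cong (swap0 r) d≡)
      p≢q : p ≢ q
      p≢q refl = a≢c (sym (swap0-involutive p a))
      t≢r : t ≢ r
      t≢r refl = a≢c (sym (trans c≡ (swap0-involutive t a)))
      p≢t : p ≢ t
      p≢t refl = b≢d (sym d≡)
      square-from : ∀ {d} → d ≡ swap0 t a → p ≡ r × q ≡ t × NonAdjacent p q →
        ∃₂ λ i j → i ∈ gens n × j ∈ gens n × NonAdjacent i j ×
          (a ∷ swap0 p a ∷ swap0 q (swap0 p a) ∷ d ∷ []) ≡ square a (i , j)
      square-from refl (refl , refl , far) =
        suc p , suc q , ∈-gens⁺ {n} p<n , ∈-gens⁺ {n} q<n , Sum.map s≤s s≤s far , refl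

  square-IsCycle4 : ∀ {a : Word n} {i j} → IsPerm a → i ∈ gens n → j ∈ gens n → NonAdjacent i j →
    IsCycle4 (square a (i , j))
  square-IsCycle4 {a} ua i∈ j∈ far with ∈-gens⁻ {n} i∈ | ∈-gens⁻ {n} j∈
  ... | p , refl , p<n | q , refl , q<n =
    (ua ∷ ub ∷ uc ∷ Unique-swap0 q a ua ∷ []) ,
    ((≢-sym (swap0-moves ua p<n) ∷ ≢-sym (swap0²-moves ua p<n q<n p≢q) ∷ ≢-sym (swap0-moves ua q<n) ∷ []) ∷
     (≢-sym (swap0-moves ub q<n) ∷ (p≢q ∘ swap0-injective ua p<n q<n) ∷ []) ∷
     ((λ c≡d → swap0-moves uc p<n (trans d≡ (sym c≡d))) ∷ []) ∷ [] ∷ []) ,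
    Adj⁺ p<n refl , Adj⁺ q<n refl , Adj⁺ p<n (sym d≡) , Adj⁺ q<n (sym (swap0-involutive q a))
    where
      ub = Unique-swap0 p a ua
      uc = Unique-swap0 q _ ub
      far′ : NonAdjacent p q
      far′ = Sum.map s<s⁻¹ s<s⁻¹ far
      p≢q : p ≢ q
      p≢q = nonAdjacent⇒≢ far′
      d≡ : swap0 p (swap0 q (swap0 p a)) ≡ swap0 q a
      d≡ = trans (swap0-comm-nonAdjacent (swap0 p a) far′) (cong (swap0 q) (swap0-involutive p a))

-- Traversals of a 4-cycle

-- Every traversal of C is C re-indexed by a traversal of ι = [0 1 2 3] (traversals-reindex), so
-- the facts about traversals that do not depend on C are checked once, on ι, by evaluation.
ι : Quad (Fin 4)
ι = Vec.allFin 4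

private
  _≟ι_ : DecidableEquality (Quad (Fin 4))
  _≟ι_ = VecP.≡-dec Fin._≟_

  open MembershipDec _≟ι_ using (_∈?_)

ι-traversals-closed : All (λ σ → All (_∈ traversals ι) (traversals σ)) (traversals ι)
ι-traversals-closed = toWitness {a? = all? (λ σ → all? (_∈? traversals ι) (traversals σ)) (traversals ι)} _

ι-traversals-symmetric : All (λ σ → ι ∈ traversals σ) (traversals ι)
ι-traversals-symmetric = toWitness {a? = all? (λ σ → ι ∈? traversals σ) (traversals ι)} _

ι-traversals-unique : Unique (traversals ι)
ι-traversals-unique = toWitness {a? = UniqueDec.unique? _≟ι_ (traversals ι)} _

ι-traversals-startingAt : ∀ i → length (filter (λ σ → head σ Fin.≟ i) (traversals ι)) ≡ 2
ι-traversals-startingAt zero                   = refl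
ι-traversals-startingAt (suc zero)             = refl
ι-traversals-startingAt (suc (suc zero))       = refl
ι-traversals-startingAt (suc (suc (suc zero))) = refl

module _ {A B : Set} where

  traversals-map : ∀ (f : A → B) (C : Quad A) → traversals (Vec.map f C) ≡ map (Vec.map f) (traversals C)
  traversals-map f (a ∷ b ∷ c ∷ d ∷ []) = refl

  Vec-map-injective : ∀ {f : A → B} {k} → (∀ {x y} → f x ≡ f y → x ≡ y) →
    ∀ {u v : Vec A k} → Vec.map f u ≡ Vec.map f v → u ≡ v
  Vec-map-injective f-inj {u = []}    {[]}    _ = refl
  Vec-map-injective f-inj {u = x ∷ u} {y ∷ v} e with VecP.∷-injective e
  ... | fx≡fy , fu≡fv = cong₂ Vec._∷_ (f-inj fx≡fy) (Vec-map-injective f-inj fu≡fv)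

module _ {A : Set} where

  lookup-injective : ∀ {k} (v : Vec A k) → Unique (toList v) → ∀ {i j} → lookup v i ≡ lookup v j → i ≡ j
  lookup-injective (x ∷ v) (x∉ ∷ uv) {zero}  {zero}  _ = refl
  lookup-injective (x ∷ v) (x∉ ∷ uv) {zero}  {suc j} e = contradiction e (All.lookup x∉ (∈-toList⁺ (∈-lookup j v)))
  lookup-injective (x ∷ v) (x∉ ∷ uv) {suc i} {zero}  e = contradiction (sym e) (All.lookup x∉ (∈-toList⁺ (∈-lookup i v)))
  lookup-injective (x ∷ v) (x∉ ∷ uv) {suc i} {suc j} e = cong suc (lookup-injective v uv e)

  ∈-toList⇒lookup : ∀ {k} (v : Vec A k) {x} → x ∈ toList v → ∃ λ i → lookup v i ≡ x
  ∈-toList⇒lookup (y ∷ v) (here refl) = zero , refl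
  ∈-toList⇒lookup (y ∷ v) (there x∈) with ∈-toList⇒lookup v x∈
  ... | i , e = suc i , e

  traversals-reindex : ∀ (C : Quad A) → traversals C ≡ map (Vec.map (lookup C)) (traversals ι)
  traversals-reindex C = trans (cong traversals (sym (VecP.map-lookup-allFin C))) (traversals-map (lookup C) ι)

  ∈-traversals⁻ : ∀ {C D : Quad A} → D ∈ traversals C → ∃ λ σ → σ ∈ traversals ι × D ≡ Vec.map (lookup C) σ
  ∈-traversals⁻ {C} D∈ = ∈-map⁻ (Vec.map (lookup C)) (subst (_ ∈_) (traversals-reindex C) D∈)

  ∈-traversals⁺ : ∀ {C : Quad A} {σ} → σ ∈ traversals ι → Vec.map (lookup C) σ ∈ traversals C
  ∈-traversals⁺ {C} {σ} σ∈ = subst (Vec.map (lookup C) σ ∈_) (sym (traversals-reindex C)) (∈-map⁺ (Vec.map (lookup C)) σ∈)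

  traversals-refl : ∀ (C : Quad A) → C ∈ traversals C
  traversals-refl (a ∷ b ∷ c ∷ d ∷ []) = here refl

  traversals-sym : ∀ {C D : Quad A} → D ∈ traversals C → C ∈ traversals D
  traversals-sym {C} D∈ with ∈-traversals⁻ D∈
  ... | σ , σ∈ , refl = subst (_∈ traversals (Vec.map (lookup C) σ)) (VecP.map-lookup-allFin C)
        (subst (_ ∈_) (sym (traversals-map (lookup C) σ)) (∈-map⁺ (Vec.map (lookup C)) (All.lookup ι-traversals-symmetric σ∈)))

  traversals-trans : ∀ {C D E : Quad A} → D ∈ traversals C → E ∈ traversals D → E ∈ traversals C
  traversals-trans {C} D∈ E∈ with ∈-traversals⁻ D∈
  ... | σ , σ∈ , refl with ∈-map⁻ (Vec.map (lookup C)) (subst (_ ∈_) (traversals-map (lookup C) σ) E∈)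
  ...   | ρ , ρ∈ , refl = ∈-traversals⁺ (All.lookup (All.lookup ι-traversals-closed σ∈) ρ∈)

  traversals-unique : ∀ {C : Quad A} → Unique (toList C) → Unique (traversals C)
  traversals-unique {C} uC = subst Unique (sym (traversals-reindex C))
    (UniqueP.map⁺ (Vec-map-injective (lookup-injective C uC)) ι-traversals-unique)

  module _ (_≟_ : DecidableEquality A) where

    traversals-startingAt : ∀ {C : Quad A} {x} → Unique (toList C) → x ∈ toList C →
      length (filter (λ D → head D ≟ x) (traversals C)) ≡ 2
    traversals-startingAt {C} {x} uC x∈ with ∈-toList⇒lookup C x∈
    ... | i , refl = begin
      length (filter startsAt? (traversals C))
        ≡⟨ cong (length ∘ filter startsAt?) (traversals-reindex C) ⟩
      length (filter startsAt? (map (Vec.map (lookup C)) (traversals ι)))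
        ≡⟨ length-filter-map startsAt? (λ σ → head σ Fin.≟ i) (Vec.map (lookup C))
             (λ {σ} → to {σ}) (λ {σ} → from {σ}) (traversals ι) ⟩
      length (filter (λ σ → head σ Fin.≟ i) (traversals ι))
        ≡⟨ ι-traversals-startingAt i ⟩
      2 ∎
      where
        open ≡-Reasoning
        startsAt? = λ (D : Quad A) → head D ≟ lookup C i
        to : ∀ {σ : Quad (Fin 4)} → head (Vec.map (lookup C) σ) ≡ lookup C i → head σ ≡ i
        to {_ ∷ _} e = lookup-injective C uC e
        from : ∀ {σ : Quad (Fin 4)} → head σ ≡ i → head (Vec.map (lookup C) σ) ≡ lookup C i
        from {_ ∷ _} e = cong (lookup C) e

module _ {A : Set} where

  rotate : Quad A → Quad A
  rotate (a ∷ b ∷ c ∷ d ∷ []) = b ∷ c ∷ d ∷ a ∷ []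

  reflect : Quad A → Quad A
  reflect (a ∷ b ∷ c ∷ d ∷ []) = a ∷ d ∷ c ∷ b ∷ []

  traversals-closed : ∀ {p} (P : Quad A → Set p) → (∀ {C} → P C → P (rotate C)) → (∀ {C} → P C → P (reflect C)) →
    ∀ {C D} → P C → D ∈ traversals C → P D
  traversals-closed P rot ref {_ ∷ _ ∷ _ ∷ _ ∷ []} pC (here refl)                                                 = pC
  traversals-closed P rot ref {_ ∷ _ ∷ _ ∷ _ ∷ []} pC (there (here refl))                                         = rot pC
  traversals-closed P rot ref {_ ∷ _ ∷ _ ∷ _ ∷ []} pC (there (there (here refl)))                                 = rot (rot pC)
  traversals-closed P rot ref {_ ∷ _ ∷ _ ∷ _ ∷ []} pC (there (there (there (here refl))))                         = rot (rot (rot pC))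
  traversals-closed P rot ref {_ ∷ _ ∷ _ ∷ _ ∷ []} pC (there (there (there (there (here refl)))))                 = ref pC
  traversals-closed P rot ref {_ ∷ _ ∷ _ ∷ _ ∷ []} pC (there (there (there (there (there (here refl))))))         = rot (ref pC)
  traversals-closed P rot ref {_ ∷ _ ∷ _ ∷ _ ∷ []} pC (there (there (there (there (there (there (here refl))))))) = rot (rot (ref pC))
  traversals-closed P rot ref {_ ∷ _ ∷ _ ∷ _ ∷ []} pC (there (there (there (there (there (there (there (here refl)))))))) =
    rot (rot (rot (ref pC)))

  Cyclic : (A → A → Set) → Quad A → Set
  Cyclic R (a ∷ b ∷ c ∷ d ∷ []) = R a b × R b c × R c d × R d a

  Cyclic-rotate : ∀ {R} {C : Quad A} → Cyclic R C → Cyclic R (rotate C)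
  Cyclic-rotate {C = _ ∷ _ ∷ _ ∷ _ ∷ []} (ab , bc , cd , da) = bc , cd , da , ab

  Cyclic-reflect : ∀ {R} {C : Quad A} → (∀ {x y} → R x y → R y x) → Cyclic R C → Cyclic R (reflect C)
  Cyclic-reflect {C = _ ∷ _ ∷ _ ∷ _ ∷ []} R-sym (ab , bc , cd , da) = R-sym da , R-sym cd , R-sym bc , R-sym ab

  ∈-traversal : ∀ {x} {C D : Quad A} → x ∈ toList C → D ∈ traversals C → x ∈ toList D
  ∈-traversal {x} = traversals-closed (λ D → x ∈ toList D)
    (λ { {a ∷ b ∷ c ∷ d ∷ []} → ∈-resp-↭ (↭-sym (shift a (b ∷ c ∷ d ∷ []) [])) })
    (λ { {a ∷ b ∷ c ∷ d ∷ []} → ∈-resp-↭ (prep a (↭-sym (↭-reverse (b ∷ c ∷ d ∷ [])))) })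

module _ {n : ℕ} where

  IsCycle4-rotate : ∀ {C : Quad (Word n)} → IsCycle4 C → IsCycle4 (rotate C)
  IsCycle4-rotate {C@(_ ∷ _ ∷ _ ∷ _ ∷ [])}
    ((ua ∷ ub ∷ uc ∷ ud ∷ []) , ((ab ∷ ac ∷ ad ∷ []) ∷ (bc ∷ bd ∷ []) ∷ (cd ∷ []) ∷ [] ∷ []) , adj) =
    (ub ∷ uc ∷ ud ∷ ua ∷ []) , ((bc ∷ bd ∷ ≢-sym ab ∷ []) ∷ (cd ∷ ≢-sym ac ∷ []) ∷ (≢-sym ad ∷ []) ∷ [] ∷ []) ,
    Cyclic-rotate {C = C} adj

  IsCycle4-reflect : ∀ {C : Quad (Word n)} → IsCycle4 C → IsCycle4 (reflect C)
  IsCycle4-reflect {C@(_ ∷ _ ∷ _ ∷ _ ∷ [])}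
    ((ua ∷ ub ∷ uc ∷ ud ∷ []) , ((ab ∷ ac ∷ ad ∷ []) ∷ (bc ∷ bd ∷ []) ∷ (cd ∷ []) ∷ [] ∷ []) , adj) =
    (ua ∷ ud ∷ uc ∷ ub ∷ []) , ((ad ∷ ac ∷ ab ∷ []) ∷ (≢-sym cd ∷ ≢-sym bd ∷ []) ∷ (≢-sym bc ∷ []) ∷ [] ∷ []) ,
    Cyclic-reflect {C = C} Adj-sym adj

  IsCycle4-traversal : ∀ {C D : Quad (Word n)} → IsCycle4 C → D ∈ traversals C → IsCycle4 D
  IsCycle4-traversal = traversals-closed IsCycle4 IsCycle4-rotate IsCycle4-reflect

FarPair : ℕ → ℕ × ℕ → Set
FarPair n (i , j) = i ∈ gens n × j ∈ gens n × NonAdjacent i j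

-- farPairs m enumerates FarPair (suc m): the generators of BS_(suc m) are 1, …, m.
farPairs : ℕ → List (ℕ × ℕ)
farPairs zero    = []
farPairs (suc m) = farPairs m ++ (map (_, suc m) (gens m) ++ map (suc m ,_) (gens m))

private
  nonAdjacent-partner : ∀ {m i} → i ∈ gens (suc m) → NonAdjacent i (suc m) → i ∈ gens m
  nonAdjacent-partner {m} i∈ far with ∈-gens⁻ {suc m} i∈
  ... | p , refl , sp<sm with far
  ...   | inj₁ ssp<sm = ∈-gens⁺ {m} (s<s⁻¹ ssp<sm)
  ...   | inj₂ ssm<sp = contradiction (<-trans sp<sm (<-trans (n<1+n (suc m)) ssm<sp)) (<-irrefl refl)

  nonAdjacent-last : ∀ {m i} → i ∈ gens m → NonAdjacent i (suc m)
  nonAdjacent-last {m} i∈ = inj₁ (s≤s (∈-gens⇒< {m} i∈))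

∈-farPairs⁻ : ∀ m {x} → x ∈ farPairs m → FarPair (suc m) x
∈-farPairs⁻ (suc m) x∈ with ∈-++⁻ (farPairs m) x∈
... | inj₁ x∈old with ∈-farPairs⁻ m x∈old
...   | i∈ , j∈ , far = ∈-gens-suc⁺ i∈ , ∈-gens-suc⁺ j∈ , far
∈-farPairs⁻ (suc m) x∈ | inj₂ x∈new with ∈-++⁻ (map (_, suc m) (gens m)) x∈new
... | inj₁ x∈left with ∈-map⁻ (_, suc m) x∈left
...   | i , i∈ , refl = ∈-gens-suc⁺ (∈-gens-suc⁺ i∈) , last , nonAdjacent-last {m} i∈
  where last = ∈-gens⁺ {suc (suc m)} (n<1+n (suc m))
∈-farPairs⁻ (suc m) x∈ | inj₂ x∈new | inj₂ x∈right with ∈-map⁻ (suc m ,_) x∈right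
...   | j , j∈ , refl = last , ∈-gens-suc⁺ (∈-gens-suc⁺ j∈) , Sum.swap (nonAdjacent-last {m} j∈)
  where last = ∈-gens⁺ {suc (suc m)} (n<1+n (suc m))

∈-farPairs⁺ : ∀ m {i j} → FarPair (suc m) (i , j) → (i , j) ∈ farPairs m
∈-farPairs⁺ zero    (() , _)
∈-farPairs⁺ (suc m) {i} {j} (i∈ , j∈ , far) with ∈-gens-suc⁻ i∈ | ∈-gens-suc⁻ j∈
... | inj₁ i∈′ | inj₁ j∈′ = ∈-++⁺ˡ (∈-farPairs⁺ m (i∈′ , j∈′ , far))
... | inj₁ i∈′ | inj₂ refl =
  ∈-++⁺ʳ (farPairs m) (∈-++⁺ˡ (∈-map⁺ (_, suc m) (nonAdjacent-partner i∈′ far)))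
... | inj₂ refl | inj₁ j∈′ =
  ∈-++⁺ʳ (farPairs m) (∈-++⁺ʳ (map (_, suc m) (gens m)) (∈-map⁺ (suc m ,_) (nonAdjacent-partner j∈′ (Sum.swap far))))
... | inj₂ refl | inj₂ refl = contradiction refl (nonAdjacent⇒≢ far)

farPairs-unique : ∀ m → Unique (farPairs m)
farPairs-unique zero    = []
farPairs-unique (suc m) = UniqueP.++⁺ (farPairs-unique m)
  (UniqueP.++⁺ (UniqueP.map⁺ (cong proj₁) (gens-unique m)) (UniqueP.map⁺ (cong proj₂) (gens-unique m)) left∩right)
  old∩new
  where
    left∩right : ∀ {x} → x ∈ map (_, suc m) (gens m) × x ∈ map (suc m ,_) (gens m) → ⊥
    left∩right (x∈left , x∈right) with ∈-map⁻ (_, suc m) x∈left | ∈-map⁻ (suc m ,_) x∈right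
    ... | _ , i∈ , refl | _ , _ , refl = 1+n≰n (<⇒≤ (∈-gens⇒< {m} i∈))
    old∩new : ∀ {x} → x ∈ farPairs m × x ∈ map (_, suc m) (gens m) ++ map (suc m ,_) (gens m) → ⊥
    old∩new (x∈old , x∈new) with ∈-farPairs⁻ m x∈old | ∈-++⁻ (map (_, suc m) (gens m)) x∈new
    ... | i∈ , j∈ , _ | inj₁ x∈left with ∈-map⁻ (_, suc m) x∈left
    ...   | _ , _ , refl = <-irrefl refl (∈-gens⇒< {suc m} j∈)
    old∩new (x∈old , x∈new) | i∈ , j∈ , _ | inj₂ x∈right with ∈-map⁻ (suc m ,_) x∈right
    ...   | _ , _ , refl = <-irrefl refl (∈-gens⇒< {suc m} i∈)

length-farPairs : ∀ m → length (farPairs m) ≡ (m ∸ 1) * (m ∸ 2)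
length-farPairs zero    = refl
length-farPairs (suc m) = begin
  length (farPairs m ++ (left ++ right))          ≡⟨ length-++ (farPairs m) ⟩
  length (farPairs m) + length (left ++ right)    ≡⟨ cong (length (farPairs m) +_) (length-++ left) ⟩
  length (farPairs m) + (length left + length right)
    ≡⟨ cong₂ _+_ (length-farPairs m) (cong₂ _+_ (length-new (_, suc m)) (length-new (suc m ,_))) ⟩
  (m ∸ 1) * (m ∸ 2) + ((m ∸ 1) + (m ∸ 1))         ≡⟨ step m ⟩
  m * (m ∸ 1)                                     ∎
  where
    open ≡-Reasoning
    left right : List (ℕ × ℕ)
    left  = map (_, suc m) (gens m)
    right = map (suc m ,_) (gens m)
    length-new : (f : ℕ → ℕ × ℕ) → length (map f (gens m)) ≡ m ∸ 1
    length-new f = trans (length-map f (gens m)) (length-gens m)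
    step : ∀ m → (m ∸ 1) * (m ∸ 2) + ((m ∸ 1) + (m ∸ 1)) ≡ m * (m ∸ 1)
    step zero          = refl
    step (suc zero)    = refl
    step (suc (suc k)) = ring k
      where ring : ∀ k → suc k * k + (suc k + suc k) ≡ suc (suc k) * suc k
            ring = solve-∀

-- Counting 4-cycles

module _ {n : ℕ} where

  ∈-cycleSeqs⁺ : ∀ {C : Quad (Word n)} → IsCycle4 C → C ∈ cycleSeqs n
  ∈-cycleSeqs⁺ {C@(_ ∷ _ ∷ _ ∷ _ ∷ [])} c = ∈-filter⁺ isCycle4? (∈-allVecs⁺ C (All.map ∈-perms⁺ (proj₁ c))) c

  ∈-cycleSeqs⁻ : ∀ {C : Quad (Word n)} → C ∈ cycleSeqs n → IsCycle4 C
  ∈-cycleSeqs⁻ C∈ = proj₂ (∈-filter⁻ isCycle4? {xs = allVecs (perms n) 4} C∈)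

  cycleSeqs-unique : Unique (cycleSeqs n)
  cycleSeqs-unique = UniqueP.filter⁺ isCycle4? (allVecs-unique 4 (perms-unique n))

  IsCycle4⇒distinct : ∀ {C : Quad (Word n)} → IsCycle4 C → Unique (toList C)
  IsCycle4⇒distinct {_ ∷ _ ∷ _ ∷ _ ∷ []} = proj₁ ∘ proj₂

  square-injective : ∀ {a : Word n} {x y} → IsPerm a → FarPair n x → FarPair n y → square a x ≡ square a y → x ≡ y
  square-injective {a} {i , j} {i′ , j′} ua (i∈ , j∈ , _) (i′∈ , j′∈ , _) e
    with ∈-gens⁻ {n} i∈ | ∈-gens⁻ {n} j∈ | ∈-gens⁻ {n} i′∈ | ∈-gens⁻ {n} j′∈
  ... | p , refl , p<n | q , refl , q<n | p′ , refl , p′<n | q′ , refl , q′<n =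
    cong₂ (λ p q → suc p , suc q) (swap0-injective ua p<n p′<n (cong (λ C → lookup C (# 1)) e))
                                  (swap0-injective ua q<n q′<n (cong (λ C → lookup C (# 3)) e))

module _ {m : ℕ} where

  length-cyclesStartingAt : ∀ {a : Word (suc m)} → IsPerm a → (L : List (Quad (Word (suc m)))) → Unique L →
    (∀ {D} → D ∈ L → IsCycle4 D × head D ≡ a) → (∀ {D} → IsCycle4 D → head D ≡ a → D ∈ L) →
    length L ≡ length (farPairs m)
  length-cyclesStartingAt {a} ua L uL sound complete = begin
    length L                              ≡⟨ unique∧set⇒length≡ uL uSquares to from ⟩
    length (map (square a) (farPairs m))  ≡⟨ length-map (square a) (farPairs m) ⟩
    length (farPairs m)                   ∎
    where
      open ≡-Reasoning
      uSquares = Unique-map⁺-injectiveOn (square a)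
        (λ x∈ y∈ → square-injective ua (∈-farPairs⁻ m x∈) (∈-farPairs⁻ m y∈)) (farPairs-unique m)
      to : ∀ {D} → D ∈ L → D ∈ map (square a) (farPairs m)
      to {_ ∷ _ ∷ _ ∷ _ ∷ []} D∈ with sound D∈
      ... | c , refl with IsCycle4⇒square c
      ...   | i , j , i∈ , j∈ , far , e =
        subst (_∈ map (square a) (farPairs m)) (sym e) (∈-map⁺ (square a) (∈-farPairs⁺ m (i∈ , j∈ , far)))
      from : ∀ {D} → D ∈ map (square a) (farPairs m) → D ∈ L
      from D∈ with ∈-map⁻ (square a) D∈
      ... | x , x∈ , refl with ∈-farPairs⁻ m x∈
      ...   | i∈ , j∈ , far = complete (square-IsCycle4 ua i∈ j∈ far) refl

  length-cycleSeqs : length (cycleSeqs (suc m)) ≡ suc m ! * length (farPairs m)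
  length-cycleSeqs = trans
    (length-filter-cartesianProductWith isCycle4? _∷_ (perms (suc m)) (allVecs (perms (suc m)) 3) _ startingAt)
    (cong (_* length (farPairs m)) (length-perms (suc m)))
    where
      startingAt : ∀ {a} → a ∈ perms (suc m) →
        length (filter isCycle4? (map (a ∷_) (allVecs (perms (suc m)) 3))) ≡ length (farPairs m)
      startingAt {a} a∈ = length-cyclesStartingAt (∈-perms⁻ a∈) _
        (UniqueP.filter⁺ isCycle4? (UniqueP.map⁺ VecP.∷-injectiveʳ (allVecs-unique 3 (perms-unique (suc m)))))
        sound complete
        where
          sound : ∀ {D} → D ∈ filter isCycle4? (map (a ∷_) (allVecs (perms (suc m)) 3)) → IsCycle4 D × head D ≡ a
          sound D∈ with ∈-filter⁻ isCycle4? {xs = map (a ∷_) (allVecs (perms (suc m)) 3)} D∈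
          ... | D∈′ , c with ∈-map⁻ (a ∷_) D∈′
          ...   | _ , _ , refl = c , refl
          complete : ∀ {D} → IsCycle4 D → head D ≡ a → D ∈ filter isCycle4? (map (a ∷_) (allVecs (perms (suc m)) 3))
          complete {_ ∷ v@(_ ∷ _ ∷ _ ∷ [])} c refl =
            ∈-filter⁺ isCycle4? (∈-map⁺ (a ∷_) (∈-allVecs⁺ v (All.map ∈-perms⁺ (All.tail (proj₁ c))))) c

  open Orbits (traversals {Word (suc m)}) sameCycle? traversals-refl traversals-sym traversals-trans

  length-cycles4At : ∀ (π : Word (suc m)) → π ∈ perms (suc m) → length (cycles4At π) * 2 ≡ length (farPairs m)
  length-cycles4At π π∈ = begin
    length (cycles4At π) * 2
      ≡⟨ sym (length-filter≡dedup*k startsAt? through 2 uThrough closed uOrbit size) ⟩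
    length (filter startsAt? through)
      ≡⟨ length-cyclesStartingAt (∈-perms⁻ π∈) _ (UniqueP.filter⁺ startsAt? uThrough) sound complete ⟩
    length (farPairs m) ∎
    where
      open ≡-Reasoning
      startsAt? = λ (D : Quad (Word (suc m))) → head D ≟W π
      through? = λ (C : Quad (Word (suc m))) → MembershipDec._∈?_ _≟W_ π (toList C)
      through = filter through? (cycleSeqs (suc m))
      uThrough = UniqueP.filter⁺ through? cycleSeqs-unique
      ∈-through⁻ : ∀ {C} → C ∈ through → IsCycle4 C × π ∈ toList C
      ∈-through⁻ C∈ with ∈-filter⁻ through? {xs = cycleSeqs (suc m)} C∈
      ... | C∈′ , π∈C = ∈-cycleSeqs⁻ C∈′ , π∈C
      closed : ∀ {C D} → C ∈ through → D ∈ traversals C → D ∈ through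
      closed C∈ D∈ with ∈-through⁻ C∈
      ... | c , π∈C = ∈-filter⁺ through? (∈-cycleSeqs⁺ (IsCycle4-traversal c D∈)) (∈-traversal π∈C D∈)
      uOrbit : ∀ {C} → C ∈ through → Unique (traversals C)
      uOrbit = traversals-unique ∘ IsCycle4⇒distinct ∘ proj₁ ∘ ∈-through⁻
      size : ∀ {C} → C ∈ through → length (filter startsAt? (traversals C)) ≡ 2
      size C∈ with ∈-through⁻ C∈
      ... | c , π∈C = traversals-startingAt _≟W_ (IsCycle4⇒distinct c) π∈C
      sound : ∀ {D} → D ∈ filter startsAt? through → IsCycle4 D × head D ≡ π
      sound D∈ with ∈-filter⁻ startsAt? {xs = through} D∈
      ... | D∈′ , refl = proj₁ (∈-through⁻ D∈′) , refl
      complete : ∀ {D} → IsCycle4 D → head D ≡ π → D ∈ filter startsAt? through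
      complete {_ ∷ _ ∷ _ ∷ _ ∷ []} c refl = ∈-filter⁺ startsAt? (∈-filter⁺ through? (∈-cycleSeqs⁺ c) (here refl)) refl

  length-cycles4 : length (cycles4 (suc m)) * 8 ≡ suc m ! * length (farPairs m)
  length-cycles4 = trans (sym (length≡dedup*k (cycleSeqs (suc m)) 8 cycleSeqs-unique closed uOrbit size)) length-cycleSeqs
    where
      closed : ∀ {C D} → C ∈ cycleSeqs (suc m) → D ∈ traversals C → D ∈ cycleSeqs (suc m)
      closed C∈ D∈ = ∈-cycleSeqs⁺ (IsCycle4-traversal (∈-cycleSeqs⁻ C∈) D∈)
      uOrbit : ∀ {C} → C ∈ cycleSeqs (suc m) → Unique (traversals C)
      uOrbit = traversals-unique ∘ IsCycle4⇒distinct ∘ ∈-cycleSeqs⁻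
      size : ∀ {C : Quad (Word (suc m))} → C ∈ cycleSeqs (suc m) → length (traversals C) ≡ 8
      size {_ ∷ _ ∷ _ ∷ _ ∷ []} _ = refl

-- Canonical forms

·b-involutive : ∀ {n} (x : Word n) t → (x ·b t) ·b t ≡ x
·b-involutive x t = swap0-involutive (t ∸ 1) x

alternating-≤lex : ∀ {lo hi t₀ t₁ t₂ t₃} → lo < hi →
  All (λ t → t ≡ lo ⊎ t ≡ hi) (t₀ ∷ t₁ ∷ t₂ ∷ t₃ ∷ []) → t₀ ≢ t₁ → t₁ ≢ t₂ → t₂ ≢ t₃ →
  (t₀ ∷ t₁ ∷ t₂ ∷ t₃ ∷ []) ≤lex (hi ∷ lo ∷ hi ∷ lo ∷ [])
alternating-≤lex lo<hi (inj₁ refl ∷ _) _ _ _ = <≤ lo<hi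
alternating-≤lex lo<hi (inj₂ refl ∷ inj₂ refl ∷ _) t₀≢t₁ _ _ = contradiction refl t₀≢t₁
alternating-≤lex lo<hi (inj₂ refl ∷ inj₁ refl ∷ inj₁ refl ∷ _) _ t₁≢t₂ _ = contradiction refl t₁≢t₂
alternating-≤lex lo<hi (inj₂ refl ∷ inj₁ refl ∷ inj₂ refl ∷ inj₂ refl ∷ []) _ _ t₂≢t₃ = contradiction refl t₂≢t₃
alternating-≤lex lo<hi (inj₂ refl ∷ inj₁ refl ∷ inj₂ refl ∷ inj₁ refl ∷ []) _ _ _ = ≡≤ (≡≤ (≡≤ (≡≤ []≤)))

module _ {n : ℕ} {a : Word n} (ua : IsPerm a) {i j} (i∈ : i ∈ gens n) (j∈ : j ∈ gens n) (far : NonAdjacent i j) where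

  private
    Step : Word n → Word n → Set
    Step x y = y ≡ x ·b i ⊎ y ≡ x ·b j

    Step-sym : ∀ {x y} → Step x y → Step y x
    Step-sym (inj₁ refl) = inj₁ (sym (·b-involutive _ i))
    Step-sym (inj₂ refl) = inj₂ (sym (·b-involutive _ j))

    ·b-comm : ((a ·b i) ·b j) ≡ ((a ·b j) ·b i)
    ·b-comm with ∈-gens⁻ {n} i∈ | ∈-gens⁻ {n} j∈
    ... | p , refl , _ | q , refl , _ = sym (swap0-comm-nonAdjacent a (Sum.map s<s⁻¹ s<s⁻¹ far))

    square-steps : Cyclic Step (square a (i , j))
    square-steps = inj₁ refl , inj₂ refl ,
                   inj₁ (sym (trans (cong (_·b i) ·b-comm) (·b-involutive (a ·b j) i))) , inj₂ (sym (·b-involutive a j))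

    step-label : ∀ {x y t} → IsPerm x → Step x y → t ∈ gens n → y ≡ x ·b t → t ≡ i ⊎ t ≡ j
    step-label ux s t∈ y≡ with ∈-gens⁻ {n} t∈ | ∈-gens⁻ {n} i∈ | ∈-gens⁻ {n} j∈
    ... | r , refl , r<n | p , refl , p<n | q , refl , q<n with s
    ...   | inj₁ refl = inj₁ (cong suc (swap0-injective ux r<n p<n (sym y≡)))
    ...   | inj₂ refl = inj₂ (cong suc (swap0-injective ux r<n q<n (sym y≡)))

  forms-≤lex : ∀ {lo hi} → lo < hi → (∀ {t} → t ≡ i ⊎ t ≡ j → t ≡ lo ⊎ t ≡ hi) →
    ∀ s → IsFormOf s (square a (i , j)) → s ≤lex (hi ∷ lo ∷ hi ∷ lo ∷ [])
  forms-≤lex lo<hi relabel (t₀ ∷ t₁ ∷ t₂ ∷ t₃ ∷ []) form with find form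
  ... | (_ ∷ _ ∷ _ ∷ _ ∷ []) , D∈ , ((g₀ ∷ g₁ ∷ g₂ ∷ g₃ ∷ []) , t₀≢t₁ , t₁≢t₂ , t₂≢t₃ , _ , e₀ , e₁ , e₂ , e₃)
    with IsCycle4-traversal (square-IsCycle4 ua i∈ j∈ far) D∈
       | traversals-closed (Cyclic Step) (λ {C} → Cyclic-rotate {C = C}) (λ {C} → Cyclic-reflect {C = C} Step-sym) square-steps D∈
  ... | (u₀ ∷ u₁ ∷ u₂ ∷ u₃ ∷ []) , _ | s₀ , s₁ , s₂ , s₃ = alternating-≤lex lo<hi
    (relabel (step-label u₀ s₀ g₀ e₀) ∷ relabel (step-label u₁ s₁ g₁ e₁) ∷
     relabel (step-label u₂ s₂ g₂ e₂) ∷ relabel (step-label u₃ s₃ g₃ e₃) ∷ [])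
    t₀≢t₁ t₁≢t₂ t₂≢t₃

  square-canonical-< : suc i < j → IsCanonicalForm (j ∷ i ∷ j ∷ i ∷ []) (square a (i , j))
  square-canonical-< si<j =
    -- read along the traversal a, a b_j, a b_i b_j, a b_i
    there (there (there (there (here
      ((j∈ ∷ i∈ ∷ j∈ ∷ i∈ ∷ []) , ≢-sym i≢j , i≢j , ≢-sym i≢j , i≢j ,
       refl , ·b-comm , sym (·b-involutive _ j) , sym (·b-involutive a i)))))) ,
    forms-≤lex (<-trans (n<1+n i) si<j) (λ t≡ → t≡)
    where i≢j = nonAdjacent⇒≢ far

  square-canonical-> : suc j < i → IsCanonicalForm (i ∷ j ∷ i ∷ j ∷ []) (square a (i , j))
  square-canonical-> sj<i =
    here ((i∈ ∷ j∈ ∷ i∈ ∷ j∈ ∷ []) , i≢j , ≢-sym i≢j , i≢j , ≢-sym i≢j ,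
          refl , refl , sym (trans (cong (_·b i) ·b-comm) (·b-involutive (a ·b j) i)) , sym (·b-involutive a j)) ,
    forms-≤lex (<-trans (n<1+n j) sj<i) Sum.swap
    where i≢j = nonAdjacent⇒≢ far

generator-pair-bounds : ∀ {n i j} → i ∈ gens n → j ∈ gens n → suc i < j → 1 ≤ i × i < j ∸ 1 × j ∸ 1 ≤ n ∸ 2
generator-pair-bounds {n} i∈ j∈ si<j with ∈-gens⁻ {n} i∈ | ∈-gens⁻ {n} j∈
generator-pair-bounds {suc (suc n)} i∈ j∈ si<j | p , refl , _ | q , refl , s≤s (s≤s q≤n) = s≤s z≤n , s<s⁻¹ si<j , q≤n

canonical-form : ∀ {n} (C : Vec (Word n) 4) → IsCycle4 C →
  ∃₂ λ i j → 1 ≤ i × i < j ∸ 1 × j ∸ 1 ≤ n ∸ 2 × IsCanonicalForm (j ∷ i ∷ j ∷ i ∷ []) C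
canonical-form {n} (_ ∷ _ ∷ _ ∷ _ ∷ []) c@((ua ∷ _) , _) with IsCycle4⇒square c
... | i , j , i∈ , j∈ , far@(inj₁ si<j) , refl with generator-pair-bounds {n} i∈ j∈ si<j
...   | 1≤i , i<j∸1 , j∸1≤n∸2 = i , j , 1≤i , i<j∸1 , j∸1≤n∸2 , square-canonical-< ua i∈ j∈ far si<j
canonical-form {n} (_ ∷ _ ∷ _ ∷ _ ∷ []) c@((ua ∷ _) , _) | i , j , i∈ , j∈ , far@(inj₂ sj<i) , refl
  with generator-pair-bounds {n} j∈ i∈ sj<i
...   | 1≤j , j<i∸1 , i∸1≤n∸2 = j , i , 1≤j , j<i∸1 , i∸1≤n∸2 , square-canonical-> ua i∈ j∈ far sj<i

m*n≡o⇒m≡o/n : ∀ {x y} k .{{_ : NonZero k}} → x * k ≡ y → x ≡ y / k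
m*n≡o⇒m≡o/n {x} k refl = sym (m*n/n≡m x k)

theorem1 : (n : ℕ) → 4 ≤ n →
    ((π : Word n) → π ∈ perms n →
      length (cycles4At π) ≡ ((n ∸ 2) * (n ∸ 3)) / 2)
    × ((C : Vec (Word n) 4) → IsCycle4 C →
        ∃₂ λ i j → 1 ≤ i × i < j ∸ 1 × j ∸ 1 ≤ n ∸ 2 ×
          IsCanonicalForm (j ∷ i ∷ j ∷ i ∷ []) C)
    × (length (cycles4 n) ≡ ((n ∸ 2) * (n ∸ 3) * (n !)) / 8)
-- The counts hold for every n ≥ 1; the hypothesis 4 ≤ n is only used to exclude n = 0.
theorem1 (suc m) _ =
  (λ π π∈ → m*n≡o⇒m≡o/n 2 (trans (length-cycles4At π π∈) (length-farPairs m))) ,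
  canonical-form ,
  m*n≡o⇒m≡o/n 8 (trans (length-cycles4 {m}) (trans (cong (suc m ! *_) (length-farPairs m)) (*-comm (suc m !) _)))
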